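{- Let $d \ge 1$. Every set $S \subset \mathbb{N}^d$ with $|S| \le d^d$ is numerically coverable, i.e. $\sum_{i=1}^d |\pi_i(S)| \ge |S|$.
   Context: $\mathbb{N} = \{0,1,2,\dots\}$. For $S \subset \mathbb{N}^d$, $\pi_i(S)$ denotes the projection of $S$ onto the $i$-th coordinate hyperplane (i.e., deleting the $i$-th coordinate). $S$ is numerically coverable if $\sum_{i=1}^d |\pi_i(S)| \ge |S|$. -}

module Defs where

open import Data.Nat using (ℕ; suc)
import Data.Nat as ℕ
open import Data.Fin using (Fin)
open import Data.Vec using (Vec; removeAt)
open import Data.Vec.Properties using (≡-dec)
open import Data.List using (List; length; map; deduplicate; allFin)
open import Data.Nat.ListAction using (sum)
open import Relation.Binary.Definitions using (DecidableEquality)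

-- A point of ℕ^d is a vector of length d.
-- A finite set S ⊂ ℕ^d is represented by a duplicate-free list of points
-- (the Unique hypothesis is imposed in the statement); |S| = length S.

_≟ₚ_ : ∀ {n} → DecidableEquality (Vec ℕ n)
_≟ₚ_ = ≡-dec ℕ._≟_

proj : ∀ {n} → Fin (suc n) → List (Vec ℕ (suc n)) → List (Vec ℕ n)
proj i S = deduplicate _≟ₚ_ (map (λ x → removeAt x i) S)

projSum : ∀ {n} → List (Vec ℕ (suc n)) → ℕ
projSum {n} S = sum (map (λ i → length (proj i S)) (allFin (suc n)))

NumericallyCoverable : ∀ {n} → List (Vec ℕ (suc n)) → Set
NumericallyCoverable S = length S ℕ.≤ projSum S

-- Loomis–Whitney and AM–GM give d^d |S|^(d-1) ≤ (Σᵢ |πᵢ S|)^d, and with |S| ≤ d^d this yields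
-- |S|^d ≤ (Σᵢ |πᵢ S|)^d.  The inequality (d |S|)^d ≤ (Σᵢ |πᵢ S|)^d |S| is proved by induction on d,
-- slicing S along the first coordinate.  Let P = |π₁ S|, B = Σ_{i≥2} |πᵢ S| and k = d - 1.  Every slice
-- A satisfies the inequality in dimension k and has at most P points, so (k |A|)^k ≤ B_A^k P, where
-- B_A is the part of B coming from A.  Since x^k ≤ y^k P means x ≤ y P^(1/k), these bounds add up over
-- the slices to (k |S|)^k ≤ B^k P, and weighted AM–GM, maximising B^k P subject to B + P = Σᵢ |πᵢ S|,
-- finishes the step.
module Submission where

open import Defs
open import Data.Fin using (Fin; zero; suc)
open import Data.List using (List; []; _∷_; length; map; filter; deduplicate; allFin; _++_)
open import Data.List.Membership.Propositional using (_∈_)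
open import Data.List.Membership.Propositional.Properties
  using (∈-map⁺; ∈-map⁻; ∈-filter⁺; ∈-filter⁻; ∈-deduplicate⁺; ∈-deduplicate⁻; ∈-++⁺ˡ; ∈-++⁺ʳ; ∈-++⁻)
open import Data.List.Membership.Propositional.Properties.WithK using (unique∧set⇒bag)
open import Data.List.Properties
  using (length-map; length-filter; length-++; map-tabulate; map-cong; map-∘; filter-notAll)
open import Data.List.Relation.Binary.BagAndSetEquality using (_∼[_]_; set; ∼bag⇒↭)
open import Data.List.Relation.Binary.Permutation.Propositional.Properties using (↭-length)
open import Data.List.Relation.Binary.Subset.Propositional using (_⊆_)
import Data.List.Relation.Binary.Subset.Propositional.Properties as ⊆
open import Data.List.Relation.Unary.All using (All; []; _∷_)
open import Data.List.Relation.Unary.All.Properties using (all-filter)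
open import Data.List.Relation.Unary.Any using (here)
open import Data.List.Relation.Unary.Unique.Propositional using (Unique)
import Data.List.Relation.Unary.Unique.Propositional.Properties as Unique
import Data.List.Relation.Unary.Unique.DecPropositional.Properties as UniqueDec
open import Data.Nat
open import Data.Nat.Induction using (<-wellFounded)
open import Data.Nat.ListAction using (sum)
open import Data.Nat.Properties
open import Algebra.Properties.CommutativeSemigroup +-commutativeSemigroup using (interchange)
open import Data.Nat.Solver using (module +-*-Solver)
open +-*-Solver using (solve; _:+_; _:*_; _:=_; con)
open import Data.Product using (_,_; _×_; proj₂)
open import Data.Sum using (inj₁; inj₂; [_,_]′)
open import Data.Vec using (Vec; _∷_; head; tail; removeAt)
open import Data.Vec.Properties using (∷-injectiveʳ)
open import Function using (_∘_; id; mk⇔; Injective)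
open import Induction.WellFounded using (Acc; acc)
open import Relation.Binary.Construct.On using () renaming (wellFounded to on-wellFounded)
open import Relation.Binary.Definitions using (DecidableEquality)
open import Relation.Binary.PropositionalEquality using (_≡_; refl; sym; trans; cong; cong₂; subst; subst₂; module ≡-Reasoning)
open import Relation.Nullary using (¬_; ¬?; yes; no)
open import Relation.Nullary.Negation using (contradiction)
open import Relation.Unary using (Decidable)

open +-*-Solver using (solve; _:+_; _:*_; _:=_; con)

^-distribʳ-* : ∀ m n o → (m * n) ^ o ≡ m ^ o * n ^ o
^-distribʳ-* m n zero    = refl
^-distribʳ-* m n (suc o) rewrite ^-distribʳ-* m n o =
  solve 4 (λ m n x y → (m :* n) :* (x :* y) := (m :* x) :* (n :* y)) refl m n (m ^ o) (n ^ o)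

^-cancelʳ-< : ∀ o {m n} → m ^ o < n ^ o → m < n
^-cancelʳ-< o {m} {n} mᵒ<nᵒ with m <? n
... | yes m<n = m<n
... | no  m≮n = contradiction (^-monoˡ-≤ o (≮⇒≥ m≮n)) (<⇒≱ mᵒ<nᵒ)

^-cancelʳ-≤ : ∀ o .{{_ : NonZero o}} {m n} → m ^ o ≤ n ^ o → m ≤ n
^-cancelʳ-≤ o {m} {n} mᵒ≤nᵒ with m ≤? n
... | yes m≤n = m≤n
... | no  m≰n = contradiction mᵒ≤nᵒ (<⇒≱ (^-monoˡ-< o (≰⇒> m≰n)))

-- (x - m)(xʲ - mʲ) ≥ 0, with both sides moved so that no subtraction occurs.
rearrangement-≤ : ∀ j {m x} → m ≤ x → m * x ^ j + m ^ j * x ≤ m * m ^ j + x * x ^ j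
rearrangement-≤ j {m} m≤x with t , refl ← m≤n⇒∃[o]m+o≡n m≤x = begin
  m * X + Y * (m + t)     ≡⟨ solve 4 (λ m t X Y → m :* X :+ Y :* (m :+ t) := (m :* X :+ m :* Y) :+ t :* Y) refl m t X Y ⟩
  (m * X + m * Y) + t * Y ≤⟨ +-monoʳ-≤ (m * X + m * Y) (*-monoʳ-≤ t (^-monoˡ-≤ j m≤x)) ⟩
  (m * X + m * Y) + t * X ≡⟨ solve 4 (λ m t X Y → (m :* X :+ m :* Y) :+ t :* X := m :* Y :+ (m :+ t) :* X) refl m t X Y ⟩
  m * Y + (m + t) * X     ∎
  where
  open ≤-Reasoning
  X = (m + t) ^ j
  Y = m ^ j

rearrangement : ∀ j m x → m * x ^ j + m ^ j * x ≤ m * m ^ j + x * x ^ j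
rearrangement j m x with ≤-total m x
... | inj₁ m≤x = rearrangement-≤ j m≤x
... | inj₂ x≤m = subst₂ _≤_
  (solve 4 (λ m x X Y → x :* Y :+ X :* m := m :* X :+ Y :* x) refl m x (x ^ j) (m ^ j))
  (+-comm (x * x ^ j) (m * m ^ j))
  (rearrangement-≤ j x≤m)

weighted-am-gm : ∀ j m x → suc j * m * x ^ j ≤ m ^ suc j + j * x ^ suc j
weighted-am-gm zero    m x = ≤-reflexive (solve 1 (λ m → con 1 :* m :* con 1 := m :* con 1 :+ con 0) refl m)
weighted-am-gm (suc j) m x = +-cancelʳ-≤ c _ _ (begin
  suc (suc j) * m * (x * X) + c
    ≡⟨ solve 5 (λ j m x X Y → (con 2 :+ j) :* m :* (x :* X) :+ m :* Y :* x
                   := ((con 1 :+ j) :* m :* X) :* x :+ (m :* (x :* X) :+ (m :* Y) :* x)) refl j m x X Y ⟩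
  (suc j * m * X) * x + (m * (x * X) + (m * Y) * x)
    ≤⟨ +-mono-≤ (*-monoˡ-≤ x (weighted-am-gm j m x)) (rearrangement (suc j) m x) ⟩
  (m * Y + j * (x * X)) * x + (m * (m * Y) + x * (x * X))
    ≡⟨ solve 5 (λ j m x X Y → (m :* Y :+ j :* (x :* X)) :* x :+ (m :* (m :* Y) :+ x :* (x :* X))
                   := (m :* (m :* Y) :+ (con 1 :+ j) :* (x :* (x :* X))) :+ m :* Y :* x) refl j m x X Y ⟩
  m * (m * Y) + suc j * (x * (x * X)) + c ∎)
  where
  open ≤-Reasoning
  X = x ^ j
  Y = m ^ j
  c = m * Y * x

-- Weighted AM–GM at m = k(B + P), x = (k + 1)B: the product Bᵏ P is largest when B : P = k : 1.
am-gm-power-product : ∀ k .{{_ : NonZero k}} B P → suc k ^ suc k * B ^ k * P ≤ k ^ k * (B + P) ^ suc k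
am-gm-power-product k B P = *-cancelˡ-≤ k (+-cancelʳ-≤ c _ _ (begin
  k * (sk * L * Bk * P) + c
    ≡⟨ solve 6 (λ k B P L Bk sk → k :* (sk :* L :* Bk :* P) :+ k :* ((sk :* B) :* (L :* Bk))
                  := sk :* (k :* (B :+ P)) :* (L :* Bk)) refl k B P L Bk sk ⟩
  sk * (k * (B + P)) * (L * Bk)
    ≡⟨ cong (sk * (k * (B + P)) *_) (^-distribʳ-* sk B k) ⟨
  sk * (k * (B + P)) * (sk * B) ^ k
    ≤⟨ weighted-am-gm k (k * (B + P)) (sk * B) ⟩
  (k * (B + P)) * (k * (B + P)) ^ k + k * ((sk * B) * (sk * B) ^ k)
    ≡⟨ cong₂ (λ u v → (k * (B + P)) * u + k * ((sk * B) * v)) (^-distribʳ-* k (B + P) k) (^-distribʳ-* sk B k) ⟩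
  (k * (B + P)) * (K * Q) + c
    ≡⟨ cong (_+ c) (solve 5 (λ k B P K Q → (k :* (B :+ P)) :* (K :* Q) := k :* (K :* ((B :+ P) :* Q))) refl k B P K Q) ⟩
  k * (K * ((B + P) * Q)) + c ∎))
  where
  open ≤-Reasoning
  sk = suc k
  L = sk ^ k
  Bk = B ^ k
  K = k ^ k
  Q = (B + P) ^ k
  c = k * ((sk * B) * (L * Bk))

-- xᵏ ≤ yᵏ c says x ≤ y c^(1/k), a condition preserved by adding the pairs (x, y).
^-bound-+ : ∀ k .{{_ : NonZero k}} x₁ x₂ y₁ y₂ c → x₁ ^ k ≤ y₁ ^ k * c → x₂ ^ k ≤ y₂ ^ k * c →
  (x₁ + x₂) ^ k ≤ (y₁ + y₂) ^ k * c
^-bound-+ k@(suc _) x₁ x₂ zero y₂ c bound₁ bound₂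
  with refl ← m^n≡0⇒m≡0 x₁ k (n≤0⇒n≡0 bound₁) = bound₂
^-bound-+ k@(suc _) x₁ x₂ (suc y₁) zero c bound₁ bound₂
  with refl ← m^n≡0⇒m≡0 x₂ k (n≤0⇒n≡0 bound₂) rewrite +-identityʳ x₁ | +-identityʳ y₁ = bound₁
^-bound-+ k x₁ x₂ y₁@(suc _) y₂@(suc _) c bound₁ bound₂ with (x₁ + x₂) ^ k ≤? (y₁ + y₂) ^ k * c
... | yes bound = bound
... | no ¬bound = contradiction
  (+-mono-< (cross-< x₁ y₁ bound₁) (cross-< x₂ y₂ bound₂)) (<-irrefl cross-products-equal)
  where
  S = x₁ + x₂
  T = y₁ + y₂
  Tᵏc<Sᵏ = ≰⇒> ¬bound
  cross-< : ∀ x y .{{_ : NonZero y}} → x ^ k ≤ y ^ k * c → x * T < y * S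
  cross-< x y xᵏ≤yᵏc = ^-cancelʳ-< k (begin-strict
    (x * T) ^ k         ≡⟨ ^-distribʳ-* x T k ⟩
    x ^ k * T ^ k       ≤⟨ *-monoˡ-≤ (T ^ k) xᵏ≤yᵏc ⟩
    y ^ k * c * T ^ k   ≡⟨ solve 3 (λ a c t → a :* c :* t := a :* (t :* c)) refl (y ^ k) c (T ^ k) ⟩
    y ^ k * (T ^ k * c) <⟨ *-monoʳ-< (y ^ k) {{m^n≢0 y k}} Tᵏc<Sᵏ ⟩
    y ^ k * S ^ k       ≡⟨ ^-distribʳ-* y S k ⟨
    (y * S) ^ k         ∎)
    where open ≤-Reasoning
  cross-products-equal : x₁ * T + x₂ * T ≡ y₁ * S + y₂ * S
  cross-products-equal =
    solve 4 (λ a b u v → a :* (u :+ v) :+ b :* (u :+ v) := u :* (a :+ b) :+ v :* (a :+ b)) refl x₁ x₂ y₁ y₂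

^-bound-step : ∀ k .{{_ : NonZero k}} N B P → (k * N) ^ k ≤ B ^ k * P →
  (suc k * N) ^ suc k ≤ (P + B) ^ suc k * N
^-bound-step k N B P bound rewrite +-comm P B = *-cancelˡ-≤ K {{m^n≢0 k k}} (begin
  K * ((sk * N) * (sk * N) ^ k) ≡⟨ cong (λ z → K * ((sk * N) * z)) (^-distribʳ-* sk N k) ⟩
  K * ((sk * N) * (L * Nᵏ))     ≡⟨ solve 5 (λ K sk N L Nk → K :* ((sk :* N) :* (L :* Nk)) := (sk :* L) :* N :* (K :* Nk)) refl K sk N L Nᵏ ⟩
  (sk * L) * N * (K * Nᵏ)       ≡⟨ cong ((sk * L) * N *_) (^-distribʳ-* k N k) ⟨
  (sk * L) * N * (k * N) ^ k    ≤⟨ *-monoʳ-≤ ((sk * L) * N) bound ⟩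
  (sk * L) * N * (B ^ k * P)    ≡⟨ solve 4 (λ a N b P → a :* N :* (b :* P) := N :* (a :* b :* P)) refl (sk * L) N (B ^ k) P ⟩
  N * (sk * L * B ^ k * P)      ≤⟨ *-monoʳ-≤ N (am-gm-power-product k B P) ⟩
  N * (K * (B + P) ^ suc k)     ≡⟨ solve 3 (λ N K Q → N :* (K :* Q) := K :* (Q :* N)) refl N K ((B + P) ^ suc k) ⟩
  K * ((B + P) ^ suc k * N)     ∎)
  where
  open ≤-Reasoning
  sk = suc k
  K = k ^ k
  L = sk ^ k
  Nᵏ = N ^ k

^-bound⇒≤ : ∀ d .{{_ : NonZero d}} N Σ → (d * N) ^ d ≤ Σ ^ d * N → N ≤ d ^ d → N ≤ Σ
^-bound⇒≤ d zero       Σ _     _     = z≤n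
^-bound⇒≤ d N@(suc _) Σ bound N≤dᵈ = ^-cancelʳ-≤ d (*-cancelʳ-≤ (N ^ d) (Σ ^ d) N (begin
  N ^ d * N     ≤⟨ *-monoʳ-≤ (N ^ d) N≤dᵈ ⟩
  N ^ d * d ^ d ≡⟨ *-comm (N ^ d) (d ^ d) ⟩
  d ^ d * N ^ d ≡⟨ ^-distribʳ-* d N d ⟨
  (d * N) ^ d   ≤⟨ bound ⟩
  Σ ^ d * N     ∎))
  where open ≤-Reasoning

unique-∼set⇒length≡ : ∀ {A : Set} {xs ys : List A} →
  Unique xs → Unique ys → xs ∼[ set ] ys → length xs ≡ length ys
unique-∼set⇒length≡ u v xs∼ys = ↭-length (∼bag⇒↭ (unique∧set⇒bag u v xs∼ys))

module _ {A : Set} (_≟_ : DecidableEquality A) where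

  card : List A → ℕ
  card xs = length (deduplicate _≟_ xs)

  unique-deduplicate : ∀ xs → Unique (deduplicate _≟_ xs)
  unique-deduplicate = UniqueDec.deduplicate-! _≟_

  unique-⊆⇒length≤card : ∀ {xs ys} → Unique xs → xs ⊆ ys → length xs ≤ card ys
  unique-⊆⇒length≤card {xs} {ys} u xs⊆ys = ≤-trans (≤-reflexive |xs|≡|zs|) (length-filter (_∈? xs) dys)
    where
    open import Data.List.Membership.DecPropositional _≟_ using (_∈?_)
    dys = deduplicate _≟_ ys
    zs = filter (_∈? xs) dys
    |xs|≡|zs| : length xs ≡ length zs
    |xs|≡|zs| = unique-∼set⇒length≡ u (Unique.filter⁺ (_∈? xs) (unique-deduplicate ys))
      (mk⇔ (λ z∈xs → ∈-filter⁺ (_∈? xs) (∈-deduplicate⁺ _≟_ (xs⊆ys z∈xs)) z∈xs)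
           (λ z∈zs → proj₂ (∈-filter⁻ (_∈? xs) {xs = dys} z∈zs)))

card-map-injective : ∀ {A B : Set} (_≟ᴬ_ : DecidableEquality A) (_≟ᴮ_ : DecidableEquality B)
  {f : A → B} → Injective _≡_ _≡_ f → ∀ xs → card _≟ᴮ_ (map f xs) ≡ card _≟ᴬ_ xs
card-map-injective _≟ᴬ_ _≟ᴮ_ {f} f-inj xs = trans
  (unique-∼set⇒length≡ (unique-deduplicate _≟ᴮ_ (map f xs)) (Unique.map⁺ f-inj (unique-deduplicate _≟ᴬ_ xs))
    (mk⇔ (λ z∈ → mapDedup (∈-deduplicate⁻ _≟ᴮ_ (map f xs) z∈)) (λ z∈ → ∈-deduplicate⁺ _≟ᴮ_ (dedupMap z∈))))
  (length-map f (deduplicate _≟ᴬ_ xs))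
  where
  mapDedup : ∀ {z} → z ∈ map f xs → z ∈ map f (deduplicate _≟ᴬ_ xs)
  mapDedup z∈ with x , x∈ , refl ← ∈-map⁻ f z∈ = ∈-map⁺ f (∈-deduplicate⁺ _≟ᴬ_ x∈)
  dedupMap : ∀ {z} → z ∈ map f (deduplicate _≟ᴬ_ xs) → z ∈ map f xs
  dedupMap z∈ with x , x∈ , refl ← ∈-map⁻ f z∈ = ∈-map⁺ f (∈-deduplicate⁻ _≟ᴬ_ xs x∈)

card-map-partition : ∀ {V W : Set} (_≟_ : DecidableEquality W) (g : V → W) {P : V → Set} (P? : Decidable P) →
  (∀ u v → g u ≡ g v → P u → P v) → ∀ S →
  card _≟_ (map g S) ≡ card _≟_ (map g (filter P? S)) + card _≟_ (map g (filter (¬? ∘ P?) S))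
card-map-partition {V = V} _≟_ g P? g-respects-P S = trans
  (unique-∼set⇒length≡ (unique-deduplicate _≟_ (map g S))
    (Unique.++⁺ (unique-deduplicate _≟_ _) (unique-deduplicate _≟_ _) disjoint) (mk⇔ split join))
  (length-++ D₁)
  where
  dedup = deduplicate _≟_
  D₁ = dedup (map g (filter P? S))
  D₂ = dedup (map g (filter (¬? ∘ P?) S))
  disjoint : ∀ {z} → ¬ (z ∈ D₁ × z ∈ D₂)
  disjoint (z∈D₁ , z∈D₂)
    with a , a∈ , refl ← ∈-map⁻ g (∈-deduplicate⁻ _≟_ _ z∈D₁)
       | b , b∈ , ga≡gb ← ∈-map⁻ g (∈-deduplicate⁻ _≟_ _ z∈D₂)
    = proj₂ (∈-filter⁻ (¬? ∘ P?) {xs = S} b∈) (g-respects-P a b ga≡gb (proj₂ (∈-filter⁻ P? {xs = S} a∈)))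
  split : ∀ {z} → z ∈ dedup (map g S) → z ∈ D₁ ++ D₂
  split z∈ with v , v∈ , refl ← ∈-map⁻ g (∈-deduplicate⁻ _≟_ _ z∈) | P? v
  ... | yes Pv = ∈-++⁺ˡ (∈-deduplicate⁺ _≟_ (∈-map⁺ g (∈-filter⁺ P? v∈ Pv)))
  ... | no ¬Pv = ∈-++⁺ʳ D₁ (∈-deduplicate⁺ _≟_ (∈-map⁺ g (∈-filter⁺ (¬? ∘ P?) v∈ ¬Pv)))
  shrink : ∀ {Q : V → Set} (Q? : Decidable Q) → dedup (map g (filter Q? S)) ⊆ dedup (map g S)
  shrink Q? = ∈-deduplicate⁺ _≟_ ∘ ⊆.map⁺ g (⊆.filter-⊆ Q? S) ∘ ∈-deduplicate⁻ _≟_ _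
  join : ∀ {z} → z ∈ D₁ ++ D₂ → z ∈ dedup (map g S)
  join z∈ = [ shrink P? , shrink (¬? ∘ P?) ]′ (∈-++⁻ D₁ z∈)

sum-map-+ : ∀ {A : Set} (f g : A → ℕ) xs → sum (map (λ x → f x + g x) xs) ≡ sum (map f xs) + sum (map g xs)
sum-map-+ f g []       = refl
sum-map-+ f g (x ∷ xs) =
  trans (cong (f x + g x +_) (sum-map-+ f g xs)) (interchange (f x) (g x) (sum (map f xs)) (sum (map g xs)))

length-filter-partition : ∀ {A : Set} {P : A → Set} (P? : Decidable P) xs →
  length xs ≡ length (filter P? xs) + length (filter (¬? ∘ P?) xs)
length-filter-partition P? []       = refl
length-filter-partition P? (x ∷ xs) with P? x
... | yes _ = cong suc (length-filter-partition P? xs)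
... | no  _ = trans (cong suc (length-filter-partition P? xs)) (sym (+-suc _ _))

head-removeAt-suc : ∀ {m} (v : Vec ℕ (2 + m)) i → head (removeAt v (suc i)) ≡ head v
head-removeAt-suc (x ∷ y ∷ ys) i = refl

removeAt-∷-suc : ∀ {m} h (v : Vec ℕ (suc m)) i → removeAt (h ∷ v) (suc i) ≡ h ∷ removeAt v i
removeAt-∷-suc h (y ∷ ys) i = refl

removeAt-zero : ∀ {m} (v : Vec ℕ (suc m)) → removeAt v zero ≡ tail v
removeAt-zero (y ∷ ys) = refl

map-cons-tail : ∀ {m} h (A : List (Vec ℕ (suc m))) → All (λ v → head v ≡ h) A → A ≡ map (h ∷_) (map tail A)
map-cons-tail h []             []           = refl
map-cons-tail h ((y ∷ ys) ∷ A) (refl ∷ hs) = cong ((y ∷ ys) ∷_) (map-cons-tail h A hs)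

projSumTail : ∀ {m} → List (Vec ℕ (2 + m)) → ℕ
projSumTail {m} S = sum (map (λ i → length (proj (suc i) S)) (allFin (suc m)))

projSum-split : ∀ {m} (S : List (Vec ℕ (2 + m))) → projSum S ≡ length (proj zero S) + projSumTail S
projSum-split {m} S =
  cong (|π| zero +_) (cong sum (trans (map-tabulate suc |π|) (sym (map-tabulate id (|π| ∘ suc)))))
  where
  |π| : Fin (2 + m) → ℕ
  |π| i = length (proj i S)

projSumTail-map-cons : ∀ {m} h (T : List (Vec ℕ (suc m))) → projSumTail (map (h ∷_) T) ≡ projSum T
projSumTail-map-cons {m} h T = cong sum (map-cong |π-suc|≡|π| (allFin (suc m)))
  where
  |π-suc|≡|π| : ∀ i → length (proj (suc i) (map (h ∷_) T)) ≡ length (proj i T)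
  |π-suc|≡|π| i = begin
    card _≟ₚ_ (map (λ v → removeAt v (suc i)) (map (h ∷_) T)) ≡⟨ cong (card _≟ₚ_) (map-∘ T) ⟨
    card _≟ₚ_ (map (λ v → removeAt (h ∷ v) (suc i)) T)        ≡⟨ cong (card _≟ₚ_) (map-cong (λ v → removeAt-∷-suc h v i) T) ⟩
    card _≟ₚ_ (map (λ v → h ∷ removeAt v i) T)                ≡⟨ cong (card _≟ₚ_) (map-∘ T) ⟩
    card _≟ₚ_ (map (h ∷_) (map (λ v → removeAt v i) T))       ≡⟨ card-map-injective _≟ₚ_ _≟ₚ_ ∷-injectiveʳ (map (λ v → removeAt v i) T) ⟩
    card _≟ₚ_ (map (λ v → removeAt v i) T)                    ∎
    where open ≡-Reasoning

hasHead? : ∀ {m} h → Decidable (λ (v : Vec ℕ (suc m)) → head v ≡ h)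
hasHead? h v = head v ≟ h

projSumTail-partition : ∀ {m} h (S : List (Vec ℕ (2 + m))) →
  projSumTail S ≡ projSumTail (filter (hasHead? h) S) + projSumTail (filter (¬? ∘ hasHead? h) S)
projSumTail-partition {m} h S = trans
  (cong sum (map-cong (λ i → card-map-partition _≟ₚ_ (λ v → removeAt v (suc i)) (hasHead? h) (head-preserved i) S)
                      (allFin (suc m))))
  (sum-map-+ (λ i → length (proj (suc i) (filter (hasHead? h) S)))
             (λ i → length (proj (suc i) (filter (¬? ∘ hasHead? h) S))) (allFin (suc m)))
  where
  head-preserved : ∀ i (u v : Vec ℕ (2 + m)) → removeAt u (suc i) ≡ removeAt v (suc i) → head u ≡ h → head v ≡ h
  head-preserved i u v u′≡v′ refl = begin
    head v                      ≡⟨ head-removeAt-suc v i ⟨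
    head (removeAt v (suc i))   ≡⟨ cong head u′≡v′ ⟨
    head (removeAt u (suc i))   ≡⟨ head-removeAt-suc u i ⟩
    head u                      ∎
    where open ≡-Reasoning

-- The Loomis–Whitney inequality |S|ᵈ⁻¹ ≤ ∏ᵢ |πᵢ S| combined with AM–GM, multiplied by |S| to stay in ℕ.
LoomisWhitneyBound : ℕ → Set
LoomisWhitneyBound n = ∀ (S : List (Vec ℕ (suc n))) → Unique S →
  (suc n * length S) ^ suc n ≤ projSum S ^ suc n * length S

SliceBound : ∀ {m} → ℕ → List (Vec ℕ (2 + m)) → Set
SliceBound {m} M A = (suc m * length A) ^ suc m ≤ projSumTail A ^ suc m * M

SlicesAtMost : ∀ {m} → ℕ → List (Vec ℕ (suc m)) → Set
SlicesAtMost M S = ∀ h A → Unique A → A ⊆ S → All (λ v → head v ≡ h) A → length A ≤ M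

slices-at-most-|proj-zero| : ∀ {m} (S : List (Vec ℕ (2 + m))) → SlicesAtMost (length (proj zero S)) S
slices-at-most-|proj-zero| S h A u A⊆S heads = begin
  length A                                ≡⟨ length-map tail A ⟨
  length (map tail A)                     ≤⟨ unique-⊆⇒length≤card _≟ₚ_ tails-unique (⊆.map⁺ tail A⊆S) ⟩
  card _≟ₚ_ (map tail S)                  ≡⟨ cong (card _≟ₚ_) (map-cong removeAt-zero S) ⟨
  card _≟ₚ_ (map (λ v → removeAt v zero) S) ∎
  where
  open ≤-Reasoning
  tails-unique : Unique (map tail A)
  tails-unique = Unique.map⁻ (subst Unique (map-cons-tail h A heads) u)

slice-bound : ∀ {m} → LoomisWhitneyBound m → ∀ {h} {A : List (Vec ℕ (2 + m))} →
  Unique A → All (λ v → head v ≡ h) A → SliceBound (length A) A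
slice-bound {m} lw {h} {A} u heads =
  subst₂ SliceBound (length-map tail A) (sym A≡hT) (bound (map tail A) (Unique.map⁻ (subst Unique A≡hT u)))
  where
  A≡hT = map-cons-tail h A heads
  bound : ∀ (T : List (Vec ℕ (suc m))) → Unique T → SliceBound (length T) (map (h ∷_) T)
  bound T uT = subst₂ (λ N Σ → (suc m * N) ^ suc m ≤ Σ ^ suc m * length T)
    (sym (length-map (h ∷_) T)) (sym (projSumTail-map-cons h T)) (lw T uT)

slice-bound-merge : ∀ {m} M h (S : List (Vec ℕ (2 + m))) →
  SliceBound M (filter (hasHead? h) S) → SliceBound M (filter (¬? ∘ hasHead? h) S) → SliceBound M S
slice-bound-merge {m} M h S boundA boundR = subst₂ (λ N Σ → (k * N) ^ k ≤ Σ ^ k * M)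
  (sym (length-filter-partition (hasHead? h) S)) (sym (projSumTail-partition h S))
  (subst (λ x → x ^ k ≤ (projSumTail A + projSumTail R) ^ k * M) (sym (*-distribˡ-+ k (length A) (length R)))
    (^-bound-+ k (k * length A) (k * length R) (projSumTail A) (projSumTail R) M boundA boundR))
  where
  k = suc m
  A = filter (hasHead? h) S
  R = filter (¬? ∘ hasHead? h) S

bound-from-slices : ∀ {m} → LoomisWhitneyBound m → ∀ M (S : List (Vec ℕ (2 + m))) →
  Unique S → SlicesAtMost M S → SliceBound M S
bound-from-slices {m} lw M S = go S (on-wellFounded length <-wellFounded S)
  where
  go : ∀ (S : List (Vec ℕ (2 + m))) → Acc (λ A B → length A < length B) S → Unique S → SlicesAtMost M S → SliceBound M S
  go []         _              _ _ rewrite *-zeroʳ m = z≤n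
  go S@(x ∷ _) (acc shorter) u slices = slice-bound-merge M h S boundA boundR
    where
    h = head x
    A = filter (hasHead? h) S
    R = filter (¬? ∘ hasHead? h) S
    uA : Unique A
    uA = Unique.filter⁺ (hasHead? h) u
    boundA : SliceBound M A
    boundA = ≤-trans (slice-bound lw uA (all-filter (hasHead? h) S))
      (*-monoʳ-≤ (projSumTail A ^ suc m) (slices h A uA (⊆.filter-⊆ (hasHead? h) S) (all-filter (hasHead? h) S)))
    R-shorter : length R < length S
    R-shorter = filter-notAll (¬? ∘ hasHead? h) S (here λ head-x≢h → head-x≢h refl)
    boundR : SliceBound M R
    boundR = go R (shorter R-shorter) (Unique.filter⁺ (¬? ∘ hasHead? h) u)
      (λ h′ B uB B⊆R → slices h′ B uB (⊆.filter-⊆ (¬? ∘ hasHead? h) S ∘ B⊆R))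

loomisWhitneyBound : ∀ n → LoomisWhitneyBound n
loomisWhitneyBound zero    []          _ = z≤n
-- The NonZero instance for projSum S is found because S is nonempty, so projSum S reduces to a successor.
loomisWhitneyBound zero    S@(_ ∷ _)  _ = begin
  (1 * N) ^ 1       ≡⟨ trans (^-identityʳ (1 * N)) (*-identityˡ N) ⟩
  N                 ≤⟨ m≤n*m N (projSum S) ⟩
  projSum S * N     ≡⟨ cong (_* N) (^-identityʳ (projSum S)) ⟨
  projSum S ^ 1 * N ∎
  where
  open ≤-Reasoning
  N = length S
loomisWhitneyBound (suc m) S           u =
  subst (λ Σ → ((2 + m) * N) ^ (2 + m) ≤ Σ ^ (2 + m) * N) (sym (projSum-split S))
    (^-bound-step (suc m) N (projSumTail S) P
      (bound-from-slices (loomisWhitneyBound m) P S u (slices-at-most-|proj-zero| S)))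
  where
  N = length S
  P = length (proj zero S)

mainTheorem6 : (n : ℕ) (S : List (Vec ℕ (suc n))) →
    Unique S → length S ≤ suc n ^ suc n → NumericallyCoverable S
mainTheorem6 n S u |S|≤dᵈ = ^-bound⇒≤ (suc n) (length S) (projSum S) (loomisWhitneyBound n S u) |S|≤dᵈ
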